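{- Let $(S_1,\dots,S_k)$ be an increasing partition of $[n]$ into nonempty blocks, of type $C=(|S_1|,\dots,|S_k|)$. Then, in $\mathbb Z[S_n]$, the sum of all permutations $\sigma\in S_n$ such that $1_{(S_1,\dots,S_k)}\circ 1_\sigma=1_{(\{1\},\dots,\{n\})}$ equals $D_C^\ast$.
   Context: $[n]=\{1,\dots,n\}$. A partition $(S_1,\dots,S_k)$ of $[n]$ (pairwise disjoint, union $[n]$) is increasing if $s<s'$ whenever $s\in S_i$, $s'\in S_j$, $i<j$. $\mathcal T_{[n]}$ is the vector space with basis symbols $1_{(T_1,\dots,T_l)}$ for ordered partitions of $[n]$ into nonempty blocks (a symbol with empty entries means the one with them deleted), with product $1_{(S_1,\dots,S_p)}\circ 1_{(T_1,\dots,T_q)}=1_{(S_1\cap T_1,\dots,S_1\cap T_q,\dots,S_p\cap T_1,\dots,S_p\cap T_q)}$. For $\sigma\in S_n$, $1_\sigma:=1_{(\{\sigma(1)\},\dots,\{\sigma(n)\})}$. For a composition $C=(n_1,\dots,n_k)$ of $n$, $D_C\in\mathbb Z[S_n]$ is the sum of all $\sigma\in S_n$ whose descent set $\{i\in[n-1]:\sigma(i)>\sigma(i+1)\}$ is contained in $\{n_1,n_1+n_2,\dots,n_1+\cdots+n_{k-1}\}$. $\ast$ denotes the linear endomorphism of $\mathbb Z[S_n]$ with $\sigma^\ast=\sigma^{ -1}$. -}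

module Defs where

open import Data.Nat using (ℕ; zero; suc; _+_; _<_; _<ᵇ_)
open import Data.Bool using (Bool; true; false; if_then_else_)
open import Data.Fin using (Fin; toℕ)
open import Data.Fin.Subset using (Subset; _∩_; ⁅_⁆; ⊥; _∈_; Nonempty; ∣_∣)
open import Data.Fin.Permutation using (Permutation′; _⟨$⟩ʳ_; flip)
open import Data.List using (List; []; _∷_; map; filter; concatMap; allFin)
open import Data.List.Relation.Unary.All using (All)
open import Data.List.Relation.Unary.All using (all?)
open import Data.List.Relation.Unary.Any using (Any; any?)
open import Data.List.Relation.Unary.AllPairs using (AllPairs)
open import Data.Vec.Properties using (≡-dec)
open import Data.Integer using (ℤ; 0ℤ; 1ℤ)
open import Relation.Binary.PropositionalEquality using (_≡_)
open import Relation.Nullary using (¬_; Dec; yes; no; ¬?)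
import Data.Bool as B
import Data.Nat as N

-- The algebra 𝒯_[n]: basis symbols are ordered partitions of [n] into
-- nonempty blocks, encoded as lists of blocks (Subset n).
-- [n] is encoded as Fin n (element i : Fin n stands for toℕ i + 1).

OrdPart : ℕ → Set
OrdPart n = List (Subset n)

private
  _≟ₛ_ : ∀ {n} (A B : Subset n) → Dec (A ≡ B)
  _≟ₛ_ = ≡-dec B._≟_

_∘𝒯_ : ∀ {n} → OrdPart n → OrdPart n → OrdPart n
S ∘𝒯 T = filter (λ B → ¬? (B ≟ₛ ⊥)) (concatMap (λ s → map (s ∩_) T) S)

oneσ : ∀ {n} → Permutation′ n → OrdPart n
oneσ {n} σ = map (λ i → ⁅ σ ⟨$⟩ʳ i ⁆) (allFin n)

discrete : ∀ n → OrdPart n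
discrete n = map ⁅_⁆ (allFin n)

IsPartition : ∀ {n} → OrdPart n → Set
IsPartition {n} S =
  AllPairs (λ A B → ∀ x → x ∈ A → x ∈ B → Data.Empty.⊥) S
  Data.Product.× (∀ (x : Fin n) → Any (x ∈_) S)
  where import Data.Empty; import Data.Product

IsIncreasing : ∀ {n} → OrdPart n → Set
IsIncreasing S = AllPairs (λ A B → ∀ s s' → s ∈ A → s' ∈ B → toℕ s < toℕ s') S

AllNonempty : ∀ {n} → OrdPart n → Set
AllNonempty S = All Nonempty S

typeOf : ∀ {n} → OrdPart n → List ℕ
typeOf S = map ∣_∣ S

oneLine : ∀ {n} → Permutation′ n → List ℕ
oneLine {n} σ = map (λ i → suc (toℕ (σ ⟨$⟩ʳ i))) (allFin n)

descentsFrom : ℕ → List ℕ → List ℕ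
descentsFrom k [] = []
descentsFrom k (a ∷ []) = []
descentsFrom k (a ∷ b ∷ w) =
  if b <ᵇ a then k ∷ descentsFrom (suc k) (b ∷ w) else descentsFrom (suc k) (b ∷ w)

Des : ∀ {n} → Permutation′ n → List ℕ
Des σ = descentsFrom 1 (oneLine σ)

partialSumsFrom : ℕ → List ℕ → List ℕ
partialSumsFrom acc [] = []
partialSumsFrom acc (c ∷ []) = []
partialSumsFrom acc (c ∷ c' ∷ cs) = (acc + c) ∷ partialSumsFrom (acc + c) (c' ∷ cs)

descentPositions : List ℕ → List ℕ
descentPositions C = partialSumsFrom 0 C

DesContainedIn : ∀ {n} → Permutation′ n → List ℕ → Set
DesContainedIn σ C = All (λ d → Any (d ≡_) (descentPositions C)) (Des σ)

ℤS : ℕ → Set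
ℤS n = Permutation′ n → ℤ

sumWhere : ∀ {n} (P : Permutation′ n → Set) → (∀ σ → Dec (P σ)) → ℤS n
sumWhere P P? τ with P? τ
... | yes _ = 1ℤ
... | no  _ = 0ℤ

-- the linear map * with σ* = σ⁻¹ (coefficient of τ in f* is that of τ⁻¹ in f)
_* : ∀ {n} → ℤS n → ℤS n
(f *) τ = f (flip τ)

desContainedIn? : ∀ {n} (C : List ℕ) (σ : Permutation′ n) → Dec (DesContainedIn σ C)
desContainedIn? C σ = all? (λ d → any? (N._≟_ d) (descentPositions C)) (Des σ)

D : ∀ n → List ℕ → ℤS n
D n C = sumWhere (λ σ → DesContainedIn σ C) (desContainedIn? C)

ordPart? : ∀ {n} (S T : OrdPart n) → Dec (S ≡ T)
ordPart? = Data.List.Properties.≡-dec (≡-dec B._≟_)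
  where import Data.List.Properties

sumComposingToDiscrete : ∀ {n} → OrdPart n → ℤS n
sumComposingToDiscrete {n} S =
  sumWhere (λ σ → (S ∘𝒯 oneσ σ) ≡ discrete n) (λ σ → ordPart? (S ∘𝒯 oneσ σ) (discrete n))

{-# OPTIONS --safe #-}
-- Write τ⁻¹ for flip τ. Meeting 1_S with the singletons of 1_τ = ({τ(1)},…,{τ(n)}) and deleting empty
-- entries lists, block by block, the elements of each S_i in the order in which they occur in the
-- one-line word of τ, that is, sorted by τ⁻¹. As the blocks are consecutive intervals of [n], the
-- result is ({1},…,{n}) iff τ⁻¹ is increasing on every block, and, again because the blocks are
-- intervals, it suffices to check this on neighbours i, i+1 in a common block. Such neighbours are
-- exactly those with i outside the cut points n₁, n₁+n₂, …, so the condition reads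
-- Des(τ⁻¹) ⊆ {n₁, n₁+n₂, …}: the coefficient of τ on the left is that of τ⁻¹ in D_C, i.e. of τ in D_C*.
module Submission where

open import Defs
open import Data.Nat using (ℕ)
open import Data.Fin.Permutation using (Permutation′)
open import Relation.Binary.PropositionalEquality using (_≡_)

open import Data.Bool using (true; false; T; if_then_else_)
open import Data.Bool.Properties using (∧-zeroʳ)
open import Data.Fin as F using (Fin; toℕ; fromℕ<)
open import Data.Fin.Permutation using (_⟨$⟩ʳ_; _⟨$⟩ˡ_; flip; inverseˡ; inverseʳ)
open import Data.Fin.Properties using (toℕ-injective; toℕ<n; toℕ-fromℕ<; <-cmp; <-asym; <-irrefl; <-trans)
open import Data.Fin.Subset using (Subset; _∩_; ⁅_⁆; ⊥; _∈_; _∉_; ∣_∣; inside; outside)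
open import Data.Fin.Subset.Properties using (_∈?_; ∉⊥; x∈⁅x⁆; x∈⁅y⁆⇒x≡y; ∩-zeroʳ)
open import Data.List using (List; []; _∷_; _++_; map; concat; concatMap; filter; tabulate; allFin; length)
open import Data.List.Membership.Propositional using (find; lose) renaming (_∈_ to _∈ˡ_)
open import Data.List.Membership.Propositional.Properties
  using (∈-++⁻; ∈-concat⁺; ∈-concat⁺′; ∈-map⁺; ∈-map⁻; ∈-filter⁺; ∈-filter⁻; ∈-allFin; ∈-tabulate⁺)
open import Data.List.Properties
  using (filter-++; filter-accept; filter-reject; map-++; map-∘; map-cong; map-concatMap; map-injective; map-tabulate;
         length-map; tabulate-cong; ∷-injective)
open import Data.List.Relation.Unary.All as All using (All; []; _∷_)
import Data.List.Relation.Unary.All.Properties as All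
open import Data.List.Relation.Unary.Any as Any using (Any; here; there)
import Data.List.Relation.Unary.Any.Properties as Any
open import Data.List.Relation.Unary.AllPairs as AllPairs using (AllPairs; []; _∷_)
import Data.List.Relation.Unary.AllPairs.Properties as AllPairs
open import Data.Nat as ℕ using (zero; suc; _+_; _∸_; _≤_; _<ᵇ_; z≤n; s≤s)
open import Data.Nat.Properties as ℕ using (+-identityʳ; +-suc; <ᵇ⇒<; <⇒<ᵇ)
open import Data.Product using (Σ; ∃₂; _×_; _,_; proj₁; proj₂)
open import Data.Sum as Sum using (_⊎_; inj₁; inj₂; [_,_]′)
open import Data.Unit using (tt)
open import Data.Vec.Base using ([]; _∷_; here; there)
open import Function using (_∘_; _on_; id; _⇔_; mk⇔; Equivalence; Injective)
open import Function.Properties.Equivalence using (⇔-setoid)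
open import Level using (0ℓ)
open import Relation.Binary using (Rel; Asymmetric; tri<; tri≈; tri>)
open import Relation.Binary.PropositionalEquality using (refl; sym; trans; cong; cong₂; subst; subst₂; module ≡-Reasoning)
import Relation.Binary.Reasoning.Setoid as SetoidReasoning
open import Relation.Nullary using (¬_; Dec; does; yes; no; contradiction)
open import Relation.Unary using (Pred; Decidable)

module _ {a r} {A : Set a} {R : Rel A r} where

  AllPairs-compare : ∀ {xs x y} → AllPairs R xs → x ∈ˡ xs → y ∈ˡ xs → x ≡ y ⊎ R x y ⊎ R y x
  AllPairs-compare (_  ∷ _)   (here refl) (here refl) = inj₁ refl
  AllPairs-compare (px ∷ _)   (here refl) (there y∈)  = inj₂ (inj₁ (All.lookup px y∈))
  AllPairs-compare (px ∷ _)   (there x∈)  (here refl) = inj₂ (inj₂ (All.lookup px x∈))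
  AllPairs-compare (_  ∷ pxs) (there x∈)  (there y∈)  = AllPairs-compare pxs x∈ y∈

  AllPairs-++⁻ : ∀ xs {ys} → AllPairs R (xs ++ ys) → AllPairs R xs × AllPairs R ys
  AllPairs-++⁻ []       pys        = [] , pys
  AllPairs-++⁻ (x ∷ xs) (px ∷ pxs) =
    let pxs′ , pys = AllPairs-++⁻ xs pxs in All.++⁻ˡ xs px ∷ pxs′ , pys

  AllPairs-concat⁻ : ∀ {xss xs} → AllPairs R (concat xss) → xs ∈ˡ xss → AllPairs R xs
  AllPairs-concat⁻ {xs ∷ _} p (here refl) = proj₁ (AllPairs-++⁻ xs p)
  AllPairs-concat⁻ {xs ∷ _} p (there xs∈) = AllPairs-concat⁻ (proj₂ (AllPairs-++⁻ xs p)) xs∈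

  AllPairs-map-within : ∀ {p r′} {P : Pred A p} {R′ : Rel A r′} {xs} →
                        (∀ {x y} → P x → P y → R x y → R′ x y) → All P xs → AllPairs R xs → AllPairs R′ xs
  AllPairs-map-within f []         []         = []
  AllPairs-map-within f (px ∷ pxs) (rx ∷ rxs) =
    All.zipWith (λ (py , r) → f px py r) (pxs , rx) ∷ AllPairs-map-within f pxs rxs

  strictlySorted-extensional : Asymmetric R → ∀ {xs ys} → AllPairs R xs → AllPairs R ys →
                               (∀ {z} → z ∈ˡ xs → z ∈ˡ ys) → (∀ {z} → z ∈ˡ ys → z ∈ˡ xs) → xs ≡ ys
  strictlySorted-extensional asym [] [] _ _ = refl
  strictlySorted-extensional asym [] (_ ∷ _) _ ys⊆xs with () ← ys⊆xs (here refl)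
  strictlySorted-extensional asym (_ ∷ _) [] xs⊆ys _ with () ← xs⊆ys (here refl)
  strictlySorted-extensional asym {x ∷ _} {y ∷ _} (px ∷ pxs) (py ∷ pys) xs⊆ys ys⊆xs =
    cong₂ _∷_ x≡y
      (strictlySorted-extensional asym pxs pys (tails x≡y px xs⊆ys) (tails (sym x≡y) py ys⊆xs))
    where
    x≡y : x ≡ y
    x≡y with xs⊆ys (here refl) | ys⊆xs (here refl)
    ... | here x≡y   | _          = x≡y
    ... | _          | here y≡x   = sym y≡x
    ... | there x∈ys | there y∈xs = contradiction (All.lookup py x∈ys) (asym (All.lookup px y∈xs))
    tails : ∀ {u v us vs} → u ≡ v → All (R u) us → (∀ {z} → z ∈ˡ u ∷ us → z ∈ˡ v ∷ vs) →
            ∀ {z} → z ∈ˡ us → z ∈ˡ vs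
    tails refl pu us⊆vs z∈ with us⊆vs (there z∈)
    ... | here refl = contradiction (All.lookup pu z∈) (λ r → asym r r)
    ... | there z∈′ = z∈′

module _ {a} {A : Set a} {x y : A} {xs : List A} where

  ∈-if-∷⁺ˡ : ∀ {b} → T b → x ≡ y → x ∈ˡ (if b then y ∷ xs else xs)
  ∈-if-∷⁺ˡ {true} _ x≡y = here x≡y

  ∈-if-∷⁺ʳ : ∀ b → x ∈ˡ xs → x ∈ˡ (if b then y ∷ xs else xs)
  ∈-if-∷⁺ʳ true  x∈ = there x∈
  ∈-if-∷⁺ʳ false x∈ = x∈

  ∈-if-∷⁻ : ∀ b → x ∈ˡ (if b then y ∷ xs else xs) → (T b × x ≡ y) ⊎ x ∈ˡ xs
  ∈-if-∷⁻ true  (here x≡y) = inj₁ (tt , x≡y)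
  ∈-if-∷⁻ true  (there x∈) = inj₂ x∈
  ∈-if-∷⁻ false x∈         = inj₂ x∈

∩⁅⁆-∈ : ∀ {n} (s : Subset n) {x} → x ∈ s → s ∩ ⁅ x ⁆ ≡ ⁅ x ⁆
∩⁅⁆-∈ (_ ∷ s) {F.zero}  here      = cong (inside ∷_) (∩-zeroʳ s)
∩⁅⁆-∈ (b ∷ s) {F.suc x} (there x∈) = cong₂ _∷_ (∧-zeroʳ b) (∩⁅⁆-∈ s x∈)

∩⁅⁆-∉ : ∀ {n} (s : Subset n) {x} → x ∉ s → s ∩ ⁅ x ⁆ ≡ ⊥
∩⁅⁆-∉ (inside  ∷ s) {F.zero}  x∉ = contradiction here x∉
∩⁅⁆-∉ (outside ∷ s) {F.zero}  x∉ = cong (outside ∷_) (∩-zeroʳ s)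
∩⁅⁆-∉ (b ∷ s)       {F.suc x} x∉ = cong₂ _∷_ (∧-zeroʳ b) (∩⁅⁆-∉ s (x∉ ∘ there))

⁅⁆-injective : ∀ {n} {x y : Fin n} → ⁅ x ⁆ ≡ ⁅ y ⁆ → x ≡ y
⁅⁆-injective {x = x} {y} eq = x∈⁅y⁆⇒x≡y y (subst (x ∈_) eq (x∈⁅x⁆ x))

groupByBlocks : ∀ {n} → OrdPart n → List (Fin n) → List (Fin n)
groupByBlocks S L = concatMap (λ s → filter (_∈? s) L) S

meetSingletons : ∀ {n} → List (Fin n) → Subset n → List (Subset n)
meetSingletons L s = map (s ∩_) (map ⁅_⁆ L)

-- Stated for any decision procedure for nonemptiness, since the one used by _∘𝒯_ is private.
module _ {n} (nonempty? : Decidable (λ (B : Subset n) → ¬ B ≡ ⊥)) where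

  filter-meetSingletons : ∀ L s → filter nonempty? (meetSingletons L s) ≡ map ⁅_⁆ (filter (_∈? s) L)
  filter-meetSingletons []      s = refl
  filter-meetSingletons (x ∷ L) s with x ∈? s
  ... | yes x∈ rewrite ∩⁅⁆-∈ s x∈ =
    trans (filter-accept nonempty? (λ eq → ∉⊥ (subst (x ∈_) eq (x∈⁅x⁆ x))))
          (cong (⁅ x ⁆ ∷_) (filter-meetSingletons L s))
  ... | no  x∉ rewrite ∩⁅⁆-∉ s x∉ =
    trans (filter-reject nonempty? (λ ≢⊥ → ≢⊥ refl)) (filter-meetSingletons L s)

  filter-concatMap-meetSingletons : ∀ L S →
    filter nonempty? (concatMap (meetSingletons L) S) ≡ map ⁅_⁆ (groupByBlocks S L)
  filter-concatMap-meetSingletons L []      = refl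
  filter-concatMap-meetSingletons L (s ∷ S) = begin
    filter nonempty? (meetSingletons L s ++ concatMap (meetSingletons L) S)
      ≡⟨ filter-++ nonempty? (meetSingletons L s) _ ⟩
    filter nonempty? (meetSingletons L s) ++ filter nonempty? (concatMap (meetSingletons L) S)
      ≡⟨ cong₂ _++_ (filter-meetSingletons L s) (filter-concatMap-meetSingletons L S) ⟩
    map ⁅_⁆ (filter (_∈? s) L) ++ map ⁅_⁆ (groupByBlocks S L)
      ≡⟨ map-++ ⁅_⁆ (filter (_∈? s) L) _ ⟨
    map ⁅_⁆ (groupByBlocks (s ∷ S) L) ∎
    where open ≡-Reasoning

oneσ-tabulate : ∀ {n} (τ : Permutation′ n) → oneσ τ ≡ map ⁅_⁆ (tabulate (τ ⟨$⟩ʳ_))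
oneσ-tabulate τ = trans (map-tabulate id _) (sym (map-tabulate _ ⁅_⁆))

composesToDiscrete⇔groupByBlocks : ∀ {n} (S : OrdPart n) (τ : Permutation′ n) →
  (S ∘𝒯 oneσ τ ≡ discrete n) ⇔ (groupByBlocks S (tabulate (τ ⟨$⟩ʳ_)) ≡ allFin n)
composesToDiscrete⇔groupByBlocks S τ = mk⇔
  (λ eq → map-injective ⁅⁆-injective (trans (sym ∘𝒯-singletons) eq))
  (λ eq → trans ∘𝒯-singletons (cong (map ⁅_⁆) eq))
  where
  ∘𝒯-singletons : S ∘𝒯 oneσ τ ≡ map ⁅_⁆ (groupByBlocks S (tabulate (τ ⟨$⟩ʳ_)))
  ∘𝒯-singletons rewrite oneσ-tabulate τ = filter-concatMap-meetSingletons _ _ S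

MonotoneOnBlocks : ∀ {n} → OrdPart n → (Fin n → Fin n) → Set
MonotoneOnBlocks S ρ = ∀ {s} → s ∈ˡ S → ∀ {a b} → a ∈ s → b ∈ s → a F.< b → ρ a F.< ρ b

allFin-sorted : ∀ n → AllPairs F._<_ (allFin n)
allFin-sorted n = AllPairs.tabulate⁺-< id

module _ {n} {S : OrdPart n} (incr : IsIncreasing S) (cover : ∀ x → Any (x ∈_) S)
         {L : List (Fin n)} {ρ : Fin n → Fin n}
         (L-complete : ∀ x → x ∈ˡ L) (L-sorted : AllPairs (F._<_ on ρ) L) where

  private
    piece : Subset n → List (Fin n)
    piece s = filter (_∈? s) L

    ∈-piece : ∀ {s x} → x ∈ s → x ∈ˡ piece s
    ∈-piece x∈ = ∈-filter⁺ (_∈? _) (L-complete _) x∈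

    piece-⊆ : ∀ {s x} → x ∈ˡ piece s → x ∈ s
    piece-⊆ {s} x∈ = proj₂ (∈-filter⁻ (_∈? s) {xs = L} x∈)

  groupByBlocks-sorted⇒monotone : AllPairs F._<_ (groupByBlocks S L) → MonotoneOnBlocks S ρ
  groupByBlocks-sorted⇒monotone sorted {s} s∈ {a} {b} a∈ b∈ a<b
    with AllPairs-compare
           (AllPairs.zip (AllPairs-concat⁻ sorted (∈-map⁺ piece s∈) , AllPairs.filter⁺ (_∈? s) L-sorted))
           (∈-piece a∈) (∈-piece b∈)
  ... | inj₁ refl              = contradiction a<b (<-irrefl refl)
  ... | inj₂ (inj₁ (_ , ρa<ρb)) = ρa<ρb
  ... | inj₂ (inj₂ (b<a , _))  = contradiction a<b (<-asym b<a)

  monotone⇒groupByBlocks-sorted : MonotoneOnBlocks S ρ → AllPairs F._<_ (groupByBlocks S L)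
  monotone⇒groupByBlocks-sorted mono =
    AllPairs.concat⁺ (All.map⁺ (All.tabulate piece-sorted))
                     (AllPairs.map⁺ (AllPairs.map pieces-ordered incr))
    where
    ρ-order⇒order : ∀ {s} → s ∈ˡ S → ∀ {a b} → a ∈ s → b ∈ s → ρ a F.< ρ b → a F.< b
    ρ-order⇒order s∈ {a} {b} a∈ b∈ ρa<ρb with <-cmp a b
    ... | tri< a<b _ _ = a<b
    ... | tri≈ _ refl _ = contradiction ρa<ρb (<-irrefl refl)
    ... | tri> _ _ b<a = contradiction ρa<ρb (<-asym (mono s∈ b∈ a∈ b<a))
    piece-sorted : ∀ {s} → s ∈ˡ S → AllPairs F._<_ (piece s)
    piece-sorted {s} s∈ =
      AllPairs-map-within (ρ-order⇒order s∈) (All.all-filter (_∈? s) L) (AllPairs.filter⁺ (_∈? s) L-sorted)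
    pieces-ordered : ∀ {s s′} → (∀ x y → x ∈ s → y ∈ s′ → toℕ x ℕ.< toℕ y) →
                     All (λ x → All (x F.<_) (piece s′)) (piece s)
    pieces-ordered s<s′ = All.tabulate λ x∈ → All.tabulate λ y∈ → s<s′ _ _ (piece-⊆ x∈) (piece-⊆ y∈)

  groupByBlocks≡allFin⇔monotone : (groupByBlocks S L ≡ allFin n) ⇔ MonotoneOnBlocks S ρ
  groupByBlocks≡allFin⇔monotone = mk⇔ to from
    where
    to : groupByBlocks S L ≡ allFin n → MonotoneOnBlocks S ρ
    to eq = groupByBlocks-sorted⇒monotone (subst (AllPairs F._<_) (sym eq) (allFin-sorted n))
    complete : ∀ x → x ∈ˡ groupByBlocks S L
    complete x = let s , s∈ , x∈ = find (cover x) in ∈-concat⁺′ (∈-piece x∈) (∈-map⁺ piece s∈)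
    from : MonotoneOnBlocks S ρ → groupByBlocks S L ≡ allFin n
    from mono = strictlySorted-extensional <-asym (monotone⇒groupByBlocks-sorted mono) (allFin-sorted n)
                  (λ _ → ∈-allFin _) (λ _ → complete _)

range : ℕ → ℕ → List ℕ
range m zero    = []
range m (suc k) = m ∷ range (suc m) k

tabulate-range : ∀ {n} m → tabulate (λ (i : Fin n) → m + toℕ i) ≡ range m n
tabulate-range {zero}  m = refl
tabulate-range {suc n} m =
  cong₂ _∷_ (+-identityʳ m) (trans (tabulate-cong (λ i → +-suc m (toℕ i))) (tabulate-range (suc m)))

∈-range⁻ : ∀ {m k x} → x ∈ˡ range m k → m ≤ x × x ℕ.< m + k
∈-range⁻ {m} {suc k} (here refl) = ℕ.≤-refl , ℕ.m<m+n m (s≤s z≤n)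
∈-range⁻ {m} {suc k} {x} (there x∈) =
  let m<x , x<m+k = ∈-range⁻ x∈ in ℕ.<⇒≤ m<x , subst (x ℕ.<_) (sym (+-suc m k)) x<m+k

range-++⁻ : ∀ xs {ys m k} → xs ++ ys ≡ range m k →
            xs ≡ range m (length xs) × Σ ℕ λ k′ → ys ≡ range (m + length xs) k′
range-++⁻ []       {m = m} {k} eq = refl , k , subst (λ m′ → _ ≡ range m′ k) (sym (+-identityʳ m)) eq
range-++⁻ (x ∷ xs) {ys} {m} {suc k} eq with refl , eq′ ← ∷-injective eq =
  let xs≡ , k′ , ys≡ = range-++⁻ xs eq′
  in cong (m ∷_) xs≡ , k′ , subst (λ m′ → ys ≡ range m′ k′) (sym (+-suc m (length xs))) ys≡

partialSumsFrom-≥ : ∀ {acc cs y} → y ∈ˡ partialSumsFrom acc cs → acc ≤ y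
partialSumsFrom-≥ {acc} {c ∷ _ ∷ _} (here refl) = ℕ.m≤m+n acc c
partialSumsFrom-≥ {acc} {c ∷ _ ∷ _} (there y∈) = ℕ.≤-trans (ℕ.m≤m+n acc c) (partialSumsFrom-≥ y∈)

module _ {xs : List ℕ} {m k : ℕ} (xs≡ : xs ≡ range m k) where

  range-lower : ∀ {x} → x ∈ˡ xs → m ≤ x
  range-lower x∈ = proj₁ (∈-range⁻ (subst (_ ∈ˡ_) xs≡ x∈))

  range-upper : ∀ {x} → x ∈ˡ xs → x ℕ.< m + k
  range-upper x∈ = proj₂ (∈-range⁻ (subst (_ ∈ˡ_) xs≡ x∈))

Together : List (List ℕ) → ℕ → ℕ → Set
Together Ps x y = Any (λ P → x ∈ˡ P × y ∈ˡ P) Ps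

boundary-or-together : ∀ Ps {m k x} → concat Ps ≡ range m k → x ∈ˡ concat Ps → suc x ∈ˡ concat Ps →
                       suc x ∈ˡ partialSumsFrom m (map length Ps) ⊎ Together Ps x (suc x)
boundary-or-together []       _ ()
boundary-or-together (P ∷ Ps) = go P Ps
  where
  -- With the head as a separate argument the termination checker sees the recursion on the tail.
  go : ∀ P Ps {m k x} → concat (P ∷ Ps) ≡ range m k → x ∈ˡ concat (P ∷ Ps) → suc x ∈ˡ concat (P ∷ Ps) →
       suc x ∈ˡ partialSumsFrom m (map length (P ∷ Ps)) ⊎ Together (P ∷ Ps) x (suc x)
  go P [] _ x∈ sx∈ with ∈-++⁻ P x∈ | ∈-++⁻ P sx∈
  ... | inj₁ x∈P | inj₁ sx∈P = inj₂ (here (x∈P , sx∈P))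
  go P (Q ∷ Ps) eq x∈ sx∈ with range-++⁻ P eq | ∈-++⁻ P x∈ | ∈-++⁻ P sx∈
  ... | _              | inj₁ x∈P    | inj₁ sx∈P    = inj₂ (here (x∈P , sx∈P))
  ... | P≡ , _ , rest≡ | inj₁ x∈P    | inj₂ sx∈rest =
    inj₁ (here (ℕ.≤-antisym (range-upper P≡ x∈P) (range-lower rest≡ sx∈rest)))
  ... | P≡ , _ , rest≡ | inj₂ x∈rest | inj₁ sx∈P    =
    contradiction (ℕ.<-trans (ℕ.n<1+n _) (range-upper P≡ sx∈P)) (ℕ.≤⇒≯ (range-lower rest≡ x∈rest))
  ... | _  , _ , rest≡ | inj₂ x∈rest | inj₂ sx∈rest =
    Sum.map there there (go Q Ps rest≡ x∈rest sx∈rest)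

boundary⇒¬together : ∀ Ps {m k x} → concat Ps ≡ range m k → suc x ∈ˡ partialSumsFrom m (map length Ps) →
                     ¬ Together Ps x (suc x)
boundary⇒¬together (P ∷ Ps@(_ ∷ _)) {x = x} eq b∈ together with range-++⁻ P eq | b∈ | together
... | P≡ , _ , _     | here sx≡ | here (_ , sx∈P) = ℕ.<-irrefl sx≡ (range-upper P≡ sx∈P)
... | _  , _ , rest≡ | here sx≡ | there t         =
  ℕ.<-irrefl refl (subst (ℕ._≤ x) (sym sx≡) (range-lower rest≡ (∈-concat⁺ (Any.map proj₁ t))))
... | P≡ , _ , _     | there b  | here (_ , sx∈P) = ℕ.≤⇒≯ (partialSumsFrom-≥ b) (range-upper P≡ sx∈P)
... | _  , _ , rest≡ | there b  | there t         = boundary⇒¬together Ps rest≡ b t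

blockValues : ∀ {n} → Subset n → List ℕ
blockValues {n} s = map toℕ (filter (_∈? s) (allFin n))

∈-blockValues⁺ : ∀ {n} {s : Subset n} {a} → a ∈ s → toℕ a ∈ˡ blockValues s
∈-blockValues⁺ {s = s} {a} a∈ = ∈-map⁺ toℕ (∈-filter⁺ (_∈? s) (∈-allFin a) a∈)

∈-blockValues⁻ : ∀ {n} {s : Subset n} {a} → toℕ a ∈ˡ blockValues s → a ∈ s
∈-blockValues⁻ {n} {s} v∈ with ∈-map⁻ toℕ v∈
... | b , b∈ , a≡b rewrite toℕ-injective a≡b = proj₂ (∈-filter⁻ (_∈? s) {xs = allFin n} b∈)

length-filter-∈?-map-suc : ∀ {n} b (s : Subset n) xs →
                           length (filter (_∈? (b ∷ s)) (map F.suc xs)) ≡ length (filter (_∈? s) xs)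
length-filter-∈?-map-suc b s []       = refl
length-filter-∈?-map-suc b s (x ∷ xs) with does (x ∈? s)
... | true  = cong suc (length-filter-∈?-map-suc b s xs)
... | false = length-filter-∈?-map-suc b s xs

length-filter-∈?-tabulate-suc : ∀ {n} b (s : Subset n) →
  length (filter (_∈? (b ∷ s)) (tabulate F.suc)) ≡ length (filter (_∈? s) (allFin n))
length-filter-∈?-tabulate-suc b s =
  trans (cong (length ∘ filter (_∈? (b ∷ s))) (sym (map-tabulate id F.suc)))
        (length-filter-∈?-map-suc b s (allFin _))

length-filter-∈?-allFin : ∀ {n} (s : Subset n) → length (filter (_∈? s) (allFin n)) ≡ ∣ s ∣
length-filter-∈?-allFin {zero}  []            = refl
length-filter-∈?-allFin {suc n} (inside  ∷ s) =
  cong suc (trans (length-filter-∈?-tabulate-suc inside s) (length-filter-∈?-allFin s))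
length-filter-∈?-allFin {suc n} (outside ∷ s) =
  trans (length-filter-∈?-tabulate-suc outside s) (length-filter-∈?-allFin s)

length-blockValues : ∀ {n} (s : Subset n) → length (blockValues s) ≡ ∣ s ∣
length-blockValues {n} s = trans (length-map toℕ (filter (_∈? s) (allFin n))) (length-filter-∈?-allFin s)

module _ {n} {I : Subset n} (convex : ∀ {a b c} → a ∈ I → b ∈ I → a F.≤ c → c F.≤ b → c ∈ I)
         {ρ : Fin n → Fin n}
         (step : ∀ {a a′} → a ∈ I → a′ ∈ I → toℕ a′ ≡ suc (toℕ a) → ρ a F.< ρ a′) where

  monotone-from-consecutive : ∀ {a b} → a ∈ I → b ∈ I → a F.< b → ρ a F.< ρ b
  monotone-from-consecutive {a} {b} a∈ b∈ a<b =
    go (toℕ b ∸ suc (toℕ a)) b∈ (sym (ℕ.m+[n∸m]≡n a<b))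
    where
    go : ∀ k {b} → b ∈ I → toℕ b ≡ suc (toℕ a) + k → ρ a F.< ρ b
    go zero    b∈ b≡ = step a∈ b∈ (trans b≡ (+-identityʳ _))
    go (suc k) {b} b∈ b≡ = <-trans (go k c∈ c≡) (step c∈ b∈ b≡c)
      where
      b≡′ : toℕ b ≡ suc (suc (toℕ a) + k)
      b≡′ = trans b≡ (+-suc (suc (toℕ a)) k)
      c<n : suc (toℕ a) + k ℕ.< n
      c<n = ℕ.<-trans (ℕ.n<1+n _) (subst (ℕ._< n) b≡′ (toℕ<n b))
      c : Fin n
      c = fromℕ< c<n
      c≡ : toℕ c ≡ suc (toℕ a) + k
      c≡ = toℕ-fromℕ< c<n
      b≡c : toℕ b ≡ suc (toℕ c)
      b≡c = trans b≡′ (cong suc (sym c≡))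
      c∈ : c ∈ I
      c∈ = convex a∈ b∈ (subst (toℕ a ℕ.≤_) (sym c≡) (ℕ.≤-trans (ℕ.n≤1+n _) (ℕ.m≤m+n _ k)))
                        (subst (toℕ c ℕ.≤_) (sym b≡c) (ℕ.n≤1+n _))

-- Positions are 1-based, as in Des: the descent between a and its successor a′ sits at suc (toℕ a).
DescentsIn : ∀ {n} → (Fin n → Fin n) → List ℕ → Set
DescentsIn ρ D = ∀ {a a′} → toℕ a′ ≡ suc (toℕ a) → ρ a′ F.< ρ a → suc (toℕ a) ∈ˡ D

SameBlock : ∀ {n} → OrdPart n → Fin n → Fin n → Set
SameBlock S a b = Any (λ s → a ∈ s × b ∈ s) S

together⇔sameBlock : ∀ {n} (S : OrdPart n) {a a′ : Fin n} → toℕ a′ ≡ suc (toℕ a) →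
                     Together (map blockValues S) (toℕ a) (suc (toℕ a)) ⇔ SameBlock S a a′
together⇔sameBlock S a′≡ = mk⇔
  (Any.map (λ (a∈ , a′∈) → ∈-blockValues⁻ a∈ , ∈-blockValues⁻ (subst (_∈ˡ _) (sym a′≡) a′∈)) ∘ Any.map⁻)
  (Any.map⁺ ∘ Any.map (λ (a∈ , a′∈) → ∈-blockValues⁺ a∈ , subst (_∈ˡ _) a′≡ (∈-blockValues⁺ a′∈)))

descentPositions-blockValues : ∀ {n} (S : OrdPart n) →
                               descentPositions (typeOf S) ≡ partialSumsFrom 0 (map length (map blockValues S))
descentPositions-blockValues S = cong (partialSumsFrom 0) (trans (map-cong (sym ∘ length-blockValues) S) (map-∘ S))

module _ {n} {S : OrdPart n} (incr : IsIncreasing S) (cover : ∀ x → Any (x ∈_) S) where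

  concat-blockValues : concat (map blockValues S) ≡ range 0 n
  concat-blockValues = begin
    concat (map blockValues S)           ≡⟨ map-concatMap toℕ (λ s → filter (_∈? s) (allFin n)) S ⟨
    map toℕ (groupByBlocks S (allFin n)) ≡⟨ cong (map toℕ) (Equivalence.from allFin-grouped (λ _ _ _ a<b → a<b)) ⟩
    map toℕ (allFin n)                   ≡⟨ map-tabulate id toℕ ⟩
    tabulate toℕ                         ≡⟨ tabulate-range 0 ⟩
    range 0 n                            ∎
    where
    open ≡-Reasoning
    allFin-grouped = groupByBlocks≡allFin⇔monotone incr cover {ρ = id} ∈-allFin (allFin-sorted n)

  ∈-concat-blockValues : ∀ a → toℕ a ∈ˡ concat (map blockValues S)
  ∈-concat-blockValues a =
    let s , s∈ , a∈ = find (cover a) in ∈-concat⁺′ (∈-blockValues⁺ a∈) (∈-map⁺ blockValues s∈)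

  boundary-or-sameBlock : ∀ {a a′} → toℕ a′ ≡ suc (toℕ a) →
                          suc (toℕ a) ∈ˡ descentPositions (typeOf S) ⊎ SameBlock S a a′
  boundary-or-sameBlock {a} {a′} a′≡
    with boundary-or-together (map blockValues S) concat-blockValues (∈-concat-blockValues a)
                              (subst (_∈ˡ _) a′≡ (∈-concat-blockValues a′))
  ... | inj₁ b∈       = inj₁ (subst (_ ∈ˡ_) (sym (descentPositions-blockValues S)) b∈)
  ... | inj₂ together = inj₂ (Equivalence.to (together⇔sameBlock S a′≡) together)

  boundary⇒¬sameBlock : ∀ {a a′} → toℕ a′ ≡ suc (toℕ a) →
                        suc (toℕ a) ∈ˡ descentPositions (typeOf S) → ¬ SameBlock S a a′
  boundary⇒¬sameBlock a′≡ b∈ same =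
    boundary⇒¬together (map blockValues S) concat-blockValues (subst (_ ∈ˡ_) (descentPositions-blockValues S) b∈)
      (Equivalence.from (together⇔sameBlock S a′≡) same)

  block-convex : ∀ {s} → s ∈ˡ S → ∀ {a b c} → a ∈ s → b ∈ s → a F.≤ c → c F.≤ b → c ∈ s
  block-convex s∈ {a} {b} {c} a∈ b∈ a≤c c≤b with find (cover c)
  ... | s′ , s′∈ , c∈ with AllPairs-compare incr s∈ s′∈
  ...   | inj₁ refl         = c∈
  ...   | inj₂ (inj₁ s<s′)  = contradiction c≤b (ℕ.<⇒≱ (s<s′ b c b∈ c∈))
  ...   | inj₂ (inj₂ s′<s)  = contradiction a≤c (ℕ.<⇒≱ (s′<s c a c∈ a∈))

  descentsAtBoundaries⇔monotone : ∀ {ρ} → Injective _≡_ _≡_ ρ →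
                                  DescentsIn ρ (descentPositions (typeOf S)) ⇔ MonotoneOnBlocks S ρ
  descentsAtBoundaries⇔monotone {ρ} ρ-injective = mk⇔ to from
    where
    to : DescentsIn ρ (descentPositions (typeOf S)) → MonotoneOnBlocks S ρ
    to descents s∈ = monotone-from-consecutive (block-convex s∈) step
      where
      step : ∀ {a a′} → a ∈ _ → a′ ∈ _ → toℕ a′ ≡ suc (toℕ a) → ρ a F.< ρ a′
      step {a} {a′} a∈ a′∈ a′≡ with <-cmp (ρ a) (ρ a′)
      ... | tri< ρa<ρa′ _ _ = ρa<ρa′
      ... | tri≈ _ ρa≡ρa′ _ =
        contradiction (ℕ.n<1+n (toℕ a)) (ℕ.<-irrefl (trans (cong toℕ (ρ-injective ρa≡ρa′)) a′≡))
      ... | tri> _ _ ρa′<ρa =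
        contradiction (lose s∈ (a∈ , a′∈)) (boundary⇒¬sameBlock a′≡ (descents a′≡ ρa′<ρa))
    from : MonotoneOnBlocks S ρ → DescentsIn ρ (descentPositions (typeOf S))
    from mono {a} {a′} a′≡ ρa′<ρa with boundary-or-sameBlock a′≡
    ... | inj₁ b∈   = b∈
    ... | inj₂ same =
      let _ , s∈ , a∈ , a′∈ = find same
      in contradiction (mono s∈ a∈ a′∈ (subst (toℕ a ℕ.<_) (sym a′≡) (ℕ.n<1+n _))) (<-asym ρa′<ρa)

DescentAt : ∀ {m} → (Fin m → ℕ) → ℕ → ℕ → Set
DescentAt {m} g k d = ∃₂ λ (a a′ : Fin m) → toℕ a′ ≡ suc (toℕ a) × d ≡ k + toℕ a × g a′ ℕ.< g a

DescentAt-suc : ∀ {m} {g : Fin (suc m) → ℕ} {k d} → DescentAt (g ∘ F.suc) (suc k) d → DescentAt g k d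
DescentAt-suc {k = k} (a , a′ , a′≡ , d≡ , lt) =
  F.suc a , F.suc a′ , cong suc a′≡ , trans d≡ (sym (+-suc k (toℕ a))) , lt

∈-descentsFrom⁺ : ∀ {m} (g : Fin m → ℕ) k {d} → DescentAt g k d → d ∈ˡ descentsFrom k (tabulate g)
∈-descentsFrom⁺ {suc (suc m)} g k (F.zero , F.suc F.zero , refl , d≡ , lt) =
  ∈-if-∷⁺ˡ (<⇒<ᵇ lt) (trans d≡ (+-identityʳ k))
∈-descentsFrom⁺ {suc (suc m)} g k (F.suc a , F.suc a′ , a′≡ , d≡ , lt) =
  ∈-if-∷⁺ʳ (g (F.suc F.zero) <ᵇ g F.zero)
    (∈-descentsFrom⁺ (g ∘ F.suc) (suc k) (a , a′ , ℕ.suc-injective a′≡ , trans d≡ (+-suc k (toℕ a)) , lt))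

∈-descentsFrom⁻ : ∀ {m} (g : Fin m → ℕ) k {d} → d ∈ˡ descentsFrom k (tabulate g) → DescentAt g k d
∈-descentsFrom⁻ {suc (suc m)} g k d∈ =
  [ (λ (desc , d≡k) → F.zero , F.suc F.zero , refl , trans d≡k (sym (+-identityʳ k)) , <ᵇ⇒< _ _ desc)
  , (λ d∈′ → DescentAt-suc (∈-descentsFrom⁻ (g ∘ F.suc) (suc k) d∈′))
  ]′ (∈-if-∷⁻ (g (F.suc F.zero) <ᵇ g F.zero) d∈)

desContainedIn⇔descentsIn : ∀ {n} (σ : Permutation′ n) C →
                            DesContainedIn σ C ⇔ DescentsIn (σ ⟨$⟩ʳ_) (descentPositions C)
desContainedIn⇔descentsIn σ C = mk⇔ to from
  where
  g : Fin _ → ℕ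
  g i = suc (toℕ (σ ⟨$⟩ʳ i))
  Des≡ : Des σ ≡ descentsFrom 1 (tabulate g)
  Des≡ = cong (descentsFrom 1) (map-tabulate id g)
  to : DesContainedIn σ C → DescentsIn (σ ⟨$⟩ʳ_) (descentPositions C)
  to contained {a} {a′} a′≡ lt =
    All.lookup contained (subst (_ ∈ˡ_) (sym Des≡) (∈-descentsFrom⁺ g 1 (a , a′ , a′≡ , refl , ℕ.s<s lt)))
  from : DescentsIn (σ ⟨$⟩ʳ_) (descentPositions C) → DesContainedIn σ C
  from descents = All.tabulate λ d∈ →
    let _ , _ , a′≡ , d≡ , lt = ∈-descentsFrom⁻ g 1 (subst (_ ∈ˡ_) Des≡ d∈)
    in subst (_∈ˡ _) (sym d≡) (descents a′≡ (ℕ.s<s⁻¹ lt))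

sumWhere-cong : ∀ {n} {P Q : Permutation′ n → Set} (P? : ∀ σ → Dec (P σ)) (Q? : ∀ σ → Dec (Q σ)) →
                ∀ {σ τ} → P σ ⇔ Q τ → sumWhere P P? σ ≡ sumWhere Q Q? τ
sumWhere-cong P? Q? {σ} {τ} P⇔Q with P? σ | Q? τ
... | yes _  | yes _  = refl
... | no  _  | no  _  = refl
... | yes p  | no  ¬q = contradiction (Equivalence.to P⇔Q p) ¬q
... | no  ¬p | yes q  = contradiction (Equivalence.from P⇔Q q) ¬p

⟨$⟩ʳ-injective : ∀ {n} (σ : Permutation′ n) → Injective _≡_ _≡_ (σ ⟨$⟩ʳ_)
⟨$⟩ʳ-injective σ σa≡σb = trans (sym (inverseˡ σ)) (trans (cong (σ ⟨$⟩ˡ_) σa≡σb) (inverseˡ σ))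

tabulate-complete : ∀ {n} (τ : Permutation′ n) x → x ∈ˡ tabulate (τ ⟨$⟩ʳ_)
tabulate-complete τ x = subst (_∈ˡ _) (inverseʳ τ) (∈-tabulate⁺ (τ ⟨$⟩ˡ x))

tabulate-sorted : ∀ {n} (τ : Permutation′ n) → AllPairs (F._<_ on (τ ⟨$⟩ˡ_)) (tabulate (τ ⟨$⟩ʳ_))
tabulate-sorted τ = AllPairs.tabulate⁺-< (subst₂ F._<_ (sym (inverseˡ τ)) (sym (inverseˡ τ)))

mainTheorem13 : (n : ℕ) (S : OrdPart n) → IsPartition S → IsIncreasing S → AllNonempty S →
    (τ : Permutation′ n) → sumComposingToDiscrete S τ ≡ (D n (typeOf S) *) τ
mainTheorem13 n S (_ , cover) incr _ τ =
  sumWhere-cong (λ σ → ordPart? (S ∘𝒯 oneσ σ) (discrete n)) (desContainedIn? (typeOf S)) (begin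
  S ∘𝒯 oneσ τ ≡ discrete n
    ≈⟨ composesToDiscrete⇔groupByBlocks S τ ⟩
  groupByBlocks S (tabulate (τ ⟨$⟩ʳ_)) ≡ allFin n
    ≈⟨ groupByBlocks≡allFin⇔monotone incr cover (tabulate-complete τ) (tabulate-sorted τ) ⟩
  MonotoneOnBlocks S (flip τ ⟨$⟩ʳ_)
    ≈⟨ descentsAtBoundaries⇔monotone incr cover (⟨$⟩ʳ-injective (flip τ)) ⟨
  DescentsIn (flip τ ⟨$⟩ʳ_) (descentPositions (typeOf S))
    ≈⟨ desContainedIn⇔descentsIn (flip τ) (typeOf S) ⟨
  DesContainedIn (flip τ) (typeOf S) ∎)
  where open SetoidReasoning (⇔-setoid 0ℓ)
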